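{- For every scheduling type $\phi$ and every $f\in\mathcal B(\phi)$: $[\![(-\infty,f):\circ\phi]\!]=[\![0:\mathit{false}]\!]$ (i.e. the only activation satisfying $(-\infty,f):\circ\phi$ is the empty activation), and $[\![(+\infty,f):\circ\phi]\!]=[\![0:\mathit{true}]\!]$ (i.e. every activation satisfies $(+\infty,f):\circ\phi$).
   Context: Fix a set $\mathbb V$ of control variables. Let $\mathbb N_\infty=\mathbb N\cup\{ -\infty,+\infty\}$ with the usual order. For $n\in\mathbb N$ let $\underline n=\{0,1,\dots,n-1\}$. An activation is a function $\sigma:\underline n\to 2^{\mathbb V}$ (some $n\in\mathbb N$) with $\sigma(i)\subseteq\sigma(j)$ whenever $i\le j$; its length is $|\sigma|=n$, and the activation with $n=0$ is the empty activation. A sub-activation $\sigma'\subseteq\sigma$ of $\sigma:\underline n\to2^{\mathbb V}$ is an activation $\sigma':\underline m\to 2^{\mathbb V}$ such that there is a strictly increasing $g:\underline m\to\underline n$ (index embedding) with $\sigma'(i)=\sigma(g(i))$ for all $i<m$. We write $\sigma=\sigma_1\cup\sigma_2$ if $\sigma_1,\sigma_2\subseteq\sigma$ with index embeddings $g_1,g_2$ such that every $i<n$ lies in the image of $g_1$ or of $g_2$. For $i\in\mathbb N$ the shifted activation $\sigma[i,:]$ has length $\max(n-i,0)$ and $\sigma[i,:](j)=\sigma(j+i)$. Scheduling types are generated by $\phi::= A\mid \mathit{true}\mid\mathit{false}\mid\phi\wedge\phi\mid\neg\phi\mid\phi\supset\phi\mid\phi\vee\phi\mid\phi\oplus\phi\mid\phi\otimes\phi\mid\circ\phi$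 with $A\in\mathbb V$. The set of scheduling bounds $\mathcal B(\phi)$ is defined by: $\mathcal B(\mathit{false})=\mathcal B(\mathit{true})=\mathcal B(A)=\mathcal B(\neg\phi)=\underline 1=\{0\}$; $\mathcal B(\phi\wedge\psi)=\mathcal B(\phi\oplus\psi)=\mathcal B(\phi\otimes\psi)=\mathcal B(\phi)\times\mathcal B(\psi)$; $\mathcal B(\phi\vee\psi)=\{(0,f):f\in\mathcal B(\phi)\}\cup\{(1,g):g\in\mathcal B(\psi)\}$; $\mathcal B(\phi\supset\psi)$ is the set of all functions $\mathcal B(\phi)\to\mathcal B(\psi)$; $\mathcal B(\circ\phi)=\mathbb N_\infty\times\mathcal B(\phi)$. Satisfaction $\sigma\models f:\phi$ (for $f\in\mathcal B(\phi)$) is defined inductively: $\sigma\models 0:\mathit{false}$ iff $|\sigma|=0$; $\sigma\models 0:\mathit{true}$ always; $\sigma\models 0:A$ iff $A\in\sigma(i)$ for all $i<|\sigma|$; $\sigma\models(f,g):\phi\wedge\psi$ iff $\sigma\models f:\phi$ and $\sigma\models g:\psi$; $\sigma\models(0,f):\phi\vee\psi$ iff $\sigma\models f:\phi$, and $\sigma\models(1,g):\phi\vee\psi$ iff $\sigma\models g:\psi$; $\sigma\models(f,g):\phi\oplus\psi$ iff $\sigma\models f:\phi$ or $\sigma\models g:\psi$; $\sigma\models f:\phi\supset\psi$ iff for every sub-activation $\sigma'\subseteq\sigma$ and every $g\in\mathcal B(\phi)$, $\sigma'\models g:\phi$ implies $\sigma'\models f(g):\psi$; $\sigma\models(d,f):\circ\phi$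 iff $|\sigma|=0$ or there is $i\in\mathbb N$ with $0\le i\le d$ and $\sigma[i,:]\models f:\phi$; $\sigma\models(f,g):\phi\otimes\psi$ iff there are $\sigma_1,\sigma_2\subseteq\sigma$ with $\sigma=\sigma_1\cup\sigma_2$, $\sigma_1\models f:\phi$ and $\sigma_2\models g:\psi$; and $\sigma\models 0:\neg\phi$ iff $\sigma\models h:\phi\supset\mathit{false}$ where $h$ is the constant function with value $0$. For an interface $f:\phi$ let $[\![f:\phi]\!]$ be the set of all activations $\sigma$ (over $\mathbb V$) with $\sigma\models f:\phi$. -}

module Defs where

open import Level using (Level; 0ℓ) renaming (suc to lsuc)
open import Data.Nat using (ℕ; zero; suc; _+_; _∸_; _≤_; _<_; z≤n; s≤s)
open import Data.Nat.Properties using (+-suc)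
open import Data.Fin using (Fin; toℕ; fromℕ<)
open import Data.Fin.Properties using (toℕ-fromℕ<)
open import Data.Unit using (⊤; tt)
open import Data.Empty using (⊥)
open import Data.Product using (Σ; ∃; _×_; _,_)
open import Data.Sum using (_⊎_)
open import Relation.Unary using (Pred; _⊆_; _∈_; _≐_)
open import Relation.Binary.PropositionalEquality using (_≡_; refl; subst; sym)

data ℕ∞ : Set where
  -∞  : ℕ∞
  fin : ℕ → ℕ∞
  +∞  : ℕ∞

_≤∞_ : ℕ → ℕ∞ → Set
i ≤∞ -∞    = ⊥
i ≤∞ fin d = i ≤ d
i ≤∞ +∞    = ⊤

-- Activations over a set V of control variables.
-- 2^V is rendered as Pred V 0ℓ (subsets of V); equality of subsets is _≐_.

module _ (V : Set) where

  record Activation : Set₁ where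
    constructor act
    field
      len  : ℕ
      at   : Fin len → Pred V 0ℓ
      mono : ∀ (i j : Fin len) → toℕ i ≤ toℕ j → at i ⊆ at j
  open Activation public

  StrictlyIncreasing : ∀ {m n} → (Fin m → Fin n) → Set
  StrictlyIncreasing g = ∀ i j → toℕ i < toℕ j → toℕ (g i) < toℕ (g j)

  SubVia : (σ' σ : Activation) → (Fin (len σ') → Fin (len σ)) → Set
  SubVia σ' σ g = StrictlyIncreasing g × (∀ i → at σ' i ≐ at σ (g i))

  _⊑_ : Activation → Activation → Set
  σ' ⊑ σ = Σ (Fin (len σ') → Fin (len σ)) (SubVia σ' σ)

  IsUnion : (σ σ₁ σ₂ : Activation) → Set
  IsUnion σ σ₁ σ₂ =
    Σ (Fin (len σ₁) → Fin (len σ)) λ g₁ →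
    Σ (Fin (len σ₂) → Fin (len σ)) λ g₂ →
      SubVia σ₁ σ g₁ × SubVia σ₂ σ g₂ ×
      (∀ i → (∃ λ j → g₁ j ≡ i) ⊎ (∃ λ j → g₂ j ≡ i))

  private
    lemma : ∀ j n i → j < n ∸ i → j + i < n
    lemma j n zero p = subst (_< n) (sym (+-zero' j)) p
      where
        +-zero' : ∀ k → k + 0 ≡ k
        +-zero' zero = refl
        +-zero' (suc k) rewrite +-zero' k = refl
    lemma j zero (suc i) ()
    lemma j (suc n) (suc i) p rewrite +-suc j i = s≤s (lemma j n i p)

  shiftIdx : ∀ n i → Fin (n ∸ i) → Fin n
  shiftIdx n i j = fromℕ< (lemma (toℕ j) n i (Data.Fin.Properties.toℕ<n j))

  -- σ[i,:] of length max(n - i, 0) = n ∸ i, with σ[i,:](j) = σ(j + i)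
  shift : Activation → ℕ → Activation
  shift σ i = act (len σ ∸ i) (λ j → at σ (shiftIdx (len σ) i j)) mono'
    where
      mono' : ∀ (j k : Fin (len σ ∸ i)) → toℕ j ≤ toℕ k →
              at σ (shiftIdx (len σ) i j) ⊆ at σ (shiftIdx (len σ) i k)
      mono' j k le = mono σ _ _ le'
        where
          open Data.Nat.Properties using (+-monoˡ-≤)
          le' : toℕ (shiftIdx (len σ) i j) ≤ toℕ (shiftIdx (len σ) i k)
          le' rewrite toℕ-fromℕ< (lemma (toℕ j) (len σ) i (Data.Fin.Properties.toℕ<n j))
                    | toℕ-fromℕ< (lemma (toℕ k) (len σ) i (Data.Fin.Properties.toℕ<n k))
                    = +-monoˡ-≤ i le

  infixr 5 _⊃_
  infixr 6 _∨_ _⊕_ _⊗_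
  infixr 7 _∧_
  data Ty : Set where
    var   : V → Ty
    true  : Ty
    false : Ty
    _∧_   : Ty → Ty → Ty
    ¬_    : Ty → Ty
    _⊃_   : Ty → Ty → Ty
    _∨_   : Ty → Ty → Ty
    _⊕_   : Ty → Ty → Ty
    _⊗_   : Ty → Ty → Ty
    ○_    : Ty → Ty

  -- scheduling bounds B(φ); the tags 0/1 of ∨ are rendered as Fin 2 via ⊎
  B : Ty → Set
  B (var A) = Fin 1
  B true    = Fin 1
  B false   = Fin 1
  B (φ ∧ ψ) = B φ × B ψ
  B (¬ φ)   = Fin 1
  B (φ ⊃ ψ) = B φ → B ψ
  B (φ ∨ ψ) = B φ ⊎ B ψ
  B (φ ⊕ ψ) = B φ × B ψ
  B (φ ⊗ ψ) = B φ × B ψ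
  B (○ φ)   = ℕ∞ × B φ

  Sat : (φ : Ty) → Activation → B φ → Set₁
  Sat (var A) σ _ = ∀ (i : Fin (len σ)) → Level.Lift (lsuc 0ℓ) (A ∈ at σ i)
  Sat true    σ _ = Level.Lift (lsuc 0ℓ) ⊤
  Sat false   σ _ = Level.Lift (lsuc 0ℓ) (len σ ≡ 0)
  Sat (φ ∧ ψ) σ (f , g) = Sat φ σ f × Sat ψ σ g
  Sat (φ ∨ ψ) σ (Data.Sum.inj₁ f) = Sat φ σ f
  Sat (φ ∨ ψ) σ (Data.Sum.inj₂ g) = Sat ψ σ g
  Sat (φ ⊕ ψ) σ (f , g) = Sat φ σ f ⊎ Sat ψ σ g
  Sat (φ ⊃ ψ) σ f = ∀ σ' → σ' ⊑ σ → ∀ (g : B φ) → Sat φ σ' g → Sat ψ σ' (f g)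
  Sat (○ φ) σ (d , f) =
    Level.Lift (lsuc 0ℓ) (len σ ≡ 0) ⊎ Σ ℕ (λ i → Level.Lift (lsuc 0ℓ) (i ≤∞ d) × Sat φ (shift σ i) f)
  Sat (φ ⊗ ψ) σ (f , g) =
    Σ Activation λ σ₁ → Σ Activation λ σ₂ → IsUnion σ σ₁ σ₂ × Sat φ σ₁ f × Sat ψ σ₂ g
  -- σ ⊨ 0 : ¬φ  iff  σ ⊨ (const 0) : φ ⊃ false, unfolded literally
  Sat (¬ φ) σ _ = ∀ σ' → σ' ⊑ σ → ∀ (g : B φ) → Sat φ σ' g → Level.Lift (lsuc 0ℓ) (len σ' ≡ 0)

  ⟦_∶_⟧ : (φ : Ty) → B φ → Pred Activation (lsuc 0ℓ)
  ⟦ φ ∶ f ⟧ σ = Sat φ σ f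

  zero₁ : Fin 1
  zero₁ = Data.Fin.zero

module Submission where

open import Defs
open import Level using (lift)
open import Data.Nat using (zero; suc)
open import Data.Nat.Properties using (n∸n≡0)
open import Data.Fin using (Fin)
open import Data.Unit using (tt)
open import Data.Empty using (⊥; ⊥-elim)
open import Data.Product using (_×_; _,_)
open import Data.Sum using (inj₁; inj₂)
open import Relation.Unary using (_≐_)
open import Relation.Binary.PropositionalEquality using (_≡_; refl)

-- ○ with bound -∞ admits no shift, so only the empty activation survives; with
-- bound +∞ one may shift past the end, and the empty activation satisfies every
-- interface: the clauses that quantify over positions or sub-activations are
-- vacuous, and for ⊗ it splits as the union of two empty activations.

module _ (V : Set) where

  Fin-empty : ∀ {n} → n ≡ 0 → Fin n → ⊥
  Fin-empty refl ()

  ⊑-preserves-empty : ∀ σ' σ → _⊑_ V σ' σ → len σ ≡ 0 → len σ' ≡ 0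
  ⊑-preserves-empty (act zero _ _)    _ _       _   = refl
  ⊑-preserves-empty (act (suc _) _ _) _ (g , _) σ≡0 = ⊥-elim (Fin-empty σ≡0 (g Fin.zero))

  ε : Activation V
  ε = act 0 (λ ()) (λ ())

  empty-is-union-of-ε : ∀ σ → len σ ≡ 0 → IsUnion V σ ε ε
  empty-is-union-of-ε _ σ≡0 =
    (λ ()) , (λ ()) , ((λ ()) , (λ ())) , ((λ ()) , (λ ())) , λ i → ⊥-elim (Fin-empty σ≡0 i)

  Sat-empty : ∀ φ σ → len σ ≡ 0 → (f : B V φ) → Sat V φ σ f
  Sat-empty (var A) _ σ≡0 _ i = ⊥-elim (Fin-empty σ≡0 i)
  Sat-empty true    _ _   _ = lift tt
  Sat-empty false   _ σ≡0 _ = lift σ≡0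
  Sat-empty (φ ∧ ψ) σ σ≡0 (f , g) = Sat-empty φ σ σ≡0 f , Sat-empty ψ σ σ≡0 g
  Sat-empty (¬ φ)   σ σ≡0 _ σ' σ'⊑σ _ _ = lift (⊑-preserves-empty σ' σ σ'⊑σ σ≡0)
  Sat-empty (φ ⊃ ψ) σ σ≡0 f σ' σ'⊑σ g _ = Sat-empty ψ σ' (⊑-preserves-empty σ' σ σ'⊑σ σ≡0) (f g)
  Sat-empty (φ ∨ ψ) σ σ≡0 (inj₁ f) = Sat-empty φ σ σ≡0 f
  Sat-empty (φ ∨ ψ) σ σ≡0 (inj₂ g) = Sat-empty ψ σ σ≡0 g
  Sat-empty (φ ⊕ ψ) σ σ≡0 (f , _) = inj₁ (Sat-empty φ σ σ≡0 f)
  Sat-empty (φ ⊗ ψ) σ σ≡0 (f , g) =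
    ε , ε , empty-is-union-of-ε σ σ≡0 , Sat-empty φ ε refl f , Sat-empty ψ ε refl g
  Sat-empty (○ φ)   _ σ≡0 _ = inj₁ (lift σ≡0)

  ○-Sat-+∞ : ∀ φ σ (f : B V φ) → Sat V (○ φ) σ (+∞ , f)
  ○-Sat-+∞ φ σ f = inj₂ (len σ , lift tt , Sat-empty φ (shift V σ (len σ)) (n∸n≡0 (len σ)) f)

  ○-Sat-−∞⇒empty : ∀ φ σ (f : B V φ) → Sat V (○ φ) σ (-∞ , f) → Sat V false σ (zero₁ V)
  ○-Sat-−∞⇒empty φ σ f (inj₁ σ≡0) = σ≡0
  ○-Sat-−∞⇒empty φ σ f (inj₂ (_ , lift () , _))

proposition2 : (V : Set) (φ : Ty V) (f : B V φ) →
    (⟦_∶_⟧ V (○_ φ) (-∞ , f) ≐ ⟦_∶_⟧ V (false) (zero₁ V)) ×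
    (⟦_∶_⟧ V (○_ φ) (+∞ , f) ≐ ⟦_∶_⟧ V (true) (zero₁ V))
proposition2 V φ f =
  ((λ {σ} → ○-Sat-−∞⇒empty V φ σ f) , inj₁) ,
  ((λ _ → lift tt) , λ {σ} _ → ○-Sat-+∞ V φ σ f)
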